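{- Let $p\ge3$ be a prime and $\mathsf{A}=\prod_{i=1}^r\mathsf{A}_i$ a finite product of local commutative $\mathbb{F}_p$-algebras. Let $V$ be an $\mathbb{F}_p$-subspace of $\mathrm{M}_2(\mathsf{A})^0$ which is invariant under conjugation by every element of $\mathrm{SL}_2(\mathsf{A})$ and satisfies $V\cap\mathrm{M}_2(\mathbb{F}_p)^0\neq\{0\}$. Then $V=\mathrm{M}_2(\mathsf{A})^0$.
   Context: For a ring $R$, $\mathrm{M}_2(R)^0$ denotes the set of $2\times2$ matrices with entries in $R$ and trace zero; $\mathrm{M}_2(\mathbb{F}_p)^0\subseteq\mathrm{M}_2(\mathsf{A})^0$ via $\mathbb{F}_p\subseteq\mathsf{A}$. -}

module Defs where

open import Level using (Level; _⊔_)
open import Data.Nat using (ℕ; zero; suc)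
open import Data.Fin using (Fin)
open import Data.Sum using (_⊎_)
open import Data.Product using (∃; _×_)
open import Relation.Nullary using (¬_)
open import Algebra.Bundles using (CommutativeRing)

module _ {c ℓ : Level} (R : CommutativeRing c ℓ) where
  open CommutativeRing R

  IsUnit : Carrier → Set (c ⊔ ℓ)
  IsUnit x = ∃ λ y → (x * y) ≈ 1#

  IsLocal : Set (c ⊔ ℓ)
  IsLocal = (¬ (1# ≈ 0#)) × (∀ x → IsUnit x ⊎ IsUnit (1# - x))

  natR : ℕ → Carrier
  natR zero = 0#
  natR (suc n) = 1# + natR n

  -- R is an F_p-algebra: p · 1 = 0
  HasCharDividing : ℕ → Set ℓ
  HasCharDividing p = natR p ≈ 0#

module Prod {c ℓ : Level} {r : ℕ} (A : Fin r → CommutativeRing c ℓ) where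
  open CommutativeRing using (Carrier)

  El : Set c
  El = (i : Fin r) → Carrier (A i)

  _≈A_ : El → El → Set ℓ
  x ≈A y = ∀ i → CommutativeRing._≈_ (A i) (x i) (y i)

  _+A_ : El → El → El
  (x +A y) i = CommutativeRing._+_ (A i) (x i) (y i)

  _*A_ : El → El → El
  (x *A y) i = CommutativeRing._*_ (A i) (x i) (y i)

  -A_ : El → El
  (-A x) i = CommutativeRing.-_ (A i) (x i)

  0A : El
  0A i = CommutativeRing.0# (A i)

  1A : El
  1A i = CommutativeRing.1# (A i)

  -- the image of n ∈ ℕ (hence of n mod p ∈ F_p) in A
  ιA : ℕ → El
  ιA n i = natR (A i) n

  record M2 : Set c where
    constructor mat
    field
      m11 m12 m21 m22 : El
  open M2 public

  _≈M_ : M2 → M2 → Set ℓ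
  X ≈M Y = (m11 X ≈A m11 Y) × (m12 X ≈A m12 Y) × (m21 X ≈A m21 Y) × (m22 X ≈A m22 Y)

  0M : M2
  0M = mat 0A 0A 0A 0A

  _+M_ : M2 → M2 → M2
  X +M Y = mat (m11 X +A m11 Y) (m12 X +A m12 Y) (m21 X +A m21 Y) (m22 X +A m22 Y)

  _*M_ : M2 → M2 → M2
  X *M Y = mat ((m11 X *A m11 Y) +A (m12 X *A m21 Y))
               ((m11 X *A m12 Y) +A (m12 X *A m22 Y))
               ((m21 X *A m11 Y) +A (m22 X *A m21 Y))
               ((m21 X *A m12 Y) +A (m22 X *A m22 Y))

  _·M_ : El → M2 → M2
  s ·M X = mat (s *A m11 X) (s *A m12 X) (s *A m21 X) (s *A m22 X)

  tr : M2 → El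
  tr X = m11 X +A m22 X

  det : M2 → El
  det X = (m11 X *A m22 X) +A (-A (m12 X *A m21 X))

  TraceZero : M2 → Set ℓ
  TraceZero X = tr X ≈A 0A

  InSL2 : M2 → Set ℓ
  InSL2 g = det g ≈A 1A

  -- the inverse of g ∈ SL_2(A) (the adjugate, since det g = 1)
  invSL2 : M2 → M2
  invSL2 g = mat (m22 g) (-A (m12 g)) (-A (m21 g)) (m11 g)

  conj : M2 → M2 → M2
  conj g X = (g *M X) *M invSL2 g

  -- the matrix in M_2(A) given by a matrix over F_p = Fin p (entries n ↦ n · 1)
  embedFp : (a b c d : ℕ) → M2
  embedFp a b c d = mat (ιA a) (ιA b) (ιA c) (ιA d)

  record IsFpSubspaceOfSl2 {v : Level} (p : ℕ) (V : M2 → Set v) : Set (c ⊔ ℓ ⊔ v) where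
    field
      respects : ∀ {X Y} → X ≈M Y → V X → V Y
      sub      : ∀ {X} → V X → TraceZero X
      zero∈    : V 0M
      +-closed : ∀ {X Y} → V X → V Y → V (X +M Y)
      ·-closed : ∀ (k : Fin p) {X} → V X → V (ιA (Data.Fin.toℕ k) ·M X)

{-# OPTIONS --safe #-}
module Submission where

-- Write E t, F t, H t for t times the standard basis (0 1; 0 0), (0 0; 1 0), (1 0; 0 −1) of sl₂.
-- Differences of conjugates of the given X = (a b; c −a) ∈ V under the unipotents U(±1) = (1 ±1; 0 1)
-- produce some E y ∈ V with y a unit: E (2c) if c ≠ 0, E (2a) if c = 0 ≠ a, and X = E b otherwise.
-- Conjugating E y by the lower unipotents L(∓x) and subtracting gives H (2yx), hence every H s;
-- subtracting H s from its conjugates by U(−1) and L(1) gives every E t and F t, and these span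
-- M₂(A)⁰. V is closed under subtraction since −X = (p − 1) · X.

open import Defs
open import Level using (Level; _⊔_)
open import Algebra.Bundles using (CommutativeRing)
open import Algebra.Solver.Ring.AlmostCommutativeRing using (_-Raw-AlmostCommutative⟶_; fromCommutativeRing)
open import Data.Empty using (⊥-elim)
open import Data.Fin as Fin using (Fin; toℕ; fromℕ<)
open import Data.Fin.Properties using (toℕ<n; toℕ-fromℕ<)
open import Data.Integer as ℤ using (ℤ; +_; -[1+_]; _⊖_; _◃_; sign; ∣_∣)
import Data.Integer.Properties as ℤ
import Data.Maybe as Maybe
open import Data.Nat as ℕ using (ℕ; zero; suc; pred; NonZero)
import Data.Nat.Properties as ℕ
open import Data.Nat.Coprimality using (coprime-Bézout; prime⇒coprime)
open import Data.Nat.Divisibility using (_∣_; divides; >⇒∤)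
open import Data.Nat.GCD using (module Bézout)
open import Data.Nat.Primality using (Prime; prime⇒nonZero)
open import Data.Product using (_×_; _,_; proj₁; proj₂; ∃)
open import Data.Sign as Sign using (Sign)
open import Data.Vec using (Vec; _∷_; [])
open import Relation.Binary.Consequences using (dec⇒weaklyDec)
open import Relation.Binary.PropositionalEquality as ≡ using (_≡_)
open import Relation.Nullary using (¬_)

Π-commutativeRing : ∀ {i c ℓ} {I : Set i} → (I → CommutativeRing c ℓ) → CommutativeRing (i ⊔ c) (i ⊔ ℓ)
Π-commutativeRing {I = I} A = record
  { Carrier = ∀ i → R.Carrier i
  ; _≈_     = λ x y → ∀ i → R._≈_ i (x i) (y i)
  ; _+_     = λ x y i → R._+_ i (x i) (y i)
  ; _*_     = λ x y i → R._*_ i (x i) (y i)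
  ; -_      = λ x i → R.-_ i (x i)
  ; 0#      = λ i → R.0# i
  ; 1#      = λ i → R.1# i
  ; isCommutativeRing = record
    { isRing = record
      { +-isAbelianGroup = record
        { isGroup = record
          { isMonoid = record
            { isSemigroup = record
              { isMagma = record
                { isEquivalence = record
                  { refl  = λ i → R.refl i
                  ; sym   = λ x≈y i → R.sym i (x≈y i)
                  ; trans = λ x≈y y≈z i → R.trans i (x≈y i) (y≈z i)
                  }
                ; ∙-cong = λ x≈y u≈v i → R.+-cong i (x≈y i) (u≈v i)
                }
              ; assoc = λ x y z i → R.+-assoc i (x i) (y i) (z i)
              }
            ; identity = (λ x i → R.+-identityˡ i (x i)) , (λ x i → R.+-identityʳ i (x i))
            }
          ; inverse = (λ x i → R.-‿inverseˡ i (x i)) , (λ x i → R.-‿inverseʳ i (x i))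
          ; ⁻¹-cong = λ x≈y i → R.-‿cong i (x≈y i)
          }
        ; comm = λ x y i → R.+-comm i (x i) (y i)
        }
      ; *-cong     = λ x≈y u≈v i → R.*-cong i (x≈y i) (u≈v i)
      ; *-assoc    = λ x y z i → R.*-assoc i (x i) (y i) (z i)
      ; *-identity = (λ x i → R.*-identityˡ i (x i)) , (λ x i → R.*-identityʳ i (x i))
      ; distrib    = (λ x y z i → R.distribˡ i (x i) (y i) (z i)) ,
                     (λ x y z i → R.distribʳ i (x i) (y i) (z i))
      }
    ; *-comm = λ x y i → R.*-comm i (x i) (y i)
    }
  }
  where module R (i : I) = CommutativeRing (A i)

Π-isUnit : ∀ {i c ℓ} {I : Set i} (A : I → CommutativeRing c ℓ) {x : ∀ i → CommutativeRing.Carrier (A i)} →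
           (∀ i → IsUnit (A i) (x i)) → IsUnit (Π-commutativeRing A) x
Π-isUnit A u = (λ i → proj₁ (u i)) , (λ i → proj₂ (u i))

module ℤ-RingSolver {c ℓ} (R : CommutativeRing c ℓ) where
  open CommutativeRing R
  open import Algebra.Properties.Ring ring using (-0#≈0#; -‿involutive; -‿distribˡ-*; -‿distribʳ-*; -‿+-comm)
  open import Algebra.Properties.Semiring.Mult.TCOptimised semiring using (1+×; ×-homo-+; ×1-homo-*)
    renaming (_×_ to _×′_)
  open import Algebra.Properties.CommutativeSemigroup +-commutativeSemigroup using (interchange)
  open import Relation.Binary.Reasoning.Setoid setoid

  -- The optimised multiple makes fromℤ (+ 1) reduce to 1#, so that the solver's constants are
  -- definitionally the ring's 0# and 1#.
  fromℤ : ℤ → Carrier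
  fromℤ (+ n)    = n ×′ 1#
  fromℤ -[1+ n ] = - (suc n ×′ 1#)

  fromℤ-⊖ : ∀ m n → fromℤ (m ⊖ n) ≈ m ×′ 1# - n ×′ 1#
  fromℤ-⊖ zero    zero    = sym (-‿inverseʳ 0#)
  fromℤ-⊖ zero    (suc n) = sym (+-identityˡ _)
  fromℤ-⊖ (suc m) zero    = sym (trans (+-congˡ -0#≈0#) (+-identityʳ _))
  fromℤ-⊖ (suc m) (suc n) = begin
    fromℤ (suc m ⊖ suc n)            ≡⟨ ≡.cong fromℤ (ℤ.[1+m]⊖[1+n]≡m⊖n m n) ⟩
    fromℤ (m ⊖ n)                    ≈⟨ fromℤ-⊖ m n ⟩
    m ×′ 1# - n ×′ 1#                  ≈⟨ +-identityˡ _ ⟨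
    0# + (m ×′ 1# - n ×′ 1#)           ≈⟨ +-congʳ (-‿inverseʳ 1#) ⟨
    (1# - 1#) + (m ×′ 1# - n ×′ 1#)    ≈⟨ interchange _ _ _ _ ⟩
    (1# + m ×′ 1#) + (- 1# - n ×′ 1#)  ≈⟨ +-congˡ (-‿+-comm 1# _) ⟩
    (1# + m ×′ 1#) - (1# + n ×′ 1#)    ≈⟨ +-cong (1+× m 1#) (-‿cong (1+× n 1#)) ⟨
    suc m ×′ 1# - suc n ×′ 1#          ∎

  fromℤ-+ : ∀ i j → fromℤ (i ℤ.+ j) ≈ fromℤ i + fromℤ j
  fromℤ-+ (+ m)    (+ n)    = ×-homo-+ 1# m n
  fromℤ-+ (+ m)    -[1+ n ] = fromℤ-⊖ m (suc n)
  fromℤ-+ -[1+ m ] (+ n)    = trans (fromℤ-⊖ n (suc m)) (+-comm _ _)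
  fromℤ-+ -[1+ m ] -[1+ n ] = begin
    - (suc (suc (m ℕ.+ n)) ×′ 1#)        ≡⟨ ≡.cong (λ k → - (k ×′ 1#)) (ℕ.+-suc (suc m) n) ⟨
    - ((suc m ℕ.+ suc n) ×′ 1#)          ≈⟨ -‿cong (×-homo-+ 1# (suc m) (suc n)) ⟩
    - (suc m ×′ 1# + suc n ×′ 1#)         ≈⟨ -‿+-comm _ _ ⟨
    - (suc m ×′ 1#) + - (suc n ×′ 1#)     ∎

  signed : Sign → Carrier → Carrier
  signed Sign.+ x = x
  signed Sign.- x = - x

  signed-cong : ∀ s {x y} → x ≈ y → signed s x ≈ signed s y
  signed-cong Sign.+ x≈y = x≈y
  signed-cong Sign.- x≈y = -‿cong x≈y

  signed-* : ∀ s t x y → signed (s Sign.* t) (x * y) ≈ signed s x * signed t y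
  signed-* Sign.+ Sign.+ x y = refl
  signed-* Sign.+ Sign.- x y = -‿distribʳ-* x y
  signed-* Sign.- Sign.+ x y = -‿distribˡ-* x y
  signed-* Sign.- Sign.- x y = begin
    x * y         ≈⟨ *-congʳ (-‿involutive x) ⟨
    - - x * y     ≈⟨ -‿distribˡ-* (- x) y ⟨
    - (- x * y)   ≈⟨ -‿distribʳ-* (- x) y ⟩
    - x * - y     ∎

  fromℤ-◃ : ∀ s n → fromℤ (s ◃ n) ≈ signed s (n ×′ 1#)
  fromℤ-◃ Sign.+ zero    = refl
  fromℤ-◃ Sign.- zero    = sym -0#≈0#
  fromℤ-◃ Sign.+ (suc n) = refl
  fromℤ-◃ Sign.- (suc n) = refl

  fromℤ-signed : ∀ i → fromℤ i ≈ signed (sign i) (∣ i ∣ ×′ 1#)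
  fromℤ-signed (+ n)    = refl
  fromℤ-signed -[1+ n ] = refl

  fromℤ-* : ∀ i j → fromℤ (i ℤ.* j) ≈ fromℤ i * fromℤ j
  fromℤ-* i j = begin
    fromℤ (s ◃ (m ℕ.* n))                                  ≈⟨ fromℤ-◃ s (m ℕ.* n) ⟩
    signed s ((m ℕ.* n) ×′ 1#)                             ≈⟨ signed-cong s (×1-homo-* m n) ⟩
    signed s ((m ×′ 1#) * (n ×′ 1#))                       ≈⟨ signed-* (sign i) (sign j) _ _ ⟩
    signed (sign i) (m ×′ 1#) * signed (sign j) (n ×′ 1#)  ≈⟨ *-cong (fromℤ-signed i) (fromℤ-signed j) ⟨
    fromℤ i * fromℤ j                                      ∎
    where
    s = sign i Sign.* sign j
    m = ∣ i ∣
    n = ∣ j ∣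

  fromℤ-- : ∀ i → fromℤ (ℤ.- i) ≈ - fromℤ i
  fromℤ-- (+ zero)  = sym -0#≈0#
  fromℤ-- (+ suc n) = refl
  fromℤ-- -[1+ n ]  = sym (-‿involutive _)

  fromℤ-homomorphism : ℤ.+-*-rawRing -Raw-AlmostCommutative⟶ fromCommutativeRing R
  fromℤ-homomorphism = record
    { ⟦_⟧ = fromℤ ; +-homo = fromℤ-+ ; *-homo = fromℤ-* ; -‿homo = fromℤ--
    ; 0-homo = refl ; 1-homo = refl }

  open import Algebra.Solver.Ring ℤ.+-*-rawRing (fromCommutativeRing R) fromℤ-homomorphism
    (λ i j → Maybe.map (λ i≡j → reflexive (≡.cong fromℤ i≡j)) (dec⇒weaklyDec ℤ._≟_ i j)) public

module Units {c ℓ} (R : CommutativeRing c ℓ) where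
  open CommutativeRing R
  open import Algebra.Properties.CommutativeSemigroup *-commutativeSemigroup using (interchange)
  open import Relation.Binary.Reasoning.Setoid setoid

  *-preserves-isUnit : ∀ {x y} → IsUnit R x → IsUnit R y → IsUnit R (x * y)
  *-preserves-isUnit {x} {y} (x⁻¹ , xx⁻¹≈1) (y⁻¹ , yy⁻¹≈1) = x⁻¹ * y⁻¹ , (begin
    (x * y) * (x⁻¹ * y⁻¹)    ≈⟨ interchange x y x⁻¹ y⁻¹ ⟩
    (x * x⁻¹) * (y * y⁻¹)    ≈⟨ *-cong xx⁻¹≈1 yy⁻¹≈1 ⟩
    1# * 1#                  ≈⟨ *-identityˡ 1# ⟩
    1#                       ∎)

  inverse-cancelˡ : ∀ {u u⁻¹} → u * u⁻¹ ≈ 1# → ∀ x → u * (u⁻¹ * x) ≈ x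
  inverse-cancelˡ {u} {u⁻¹} uu⁻¹≈1 x = begin
    u * (u⁻¹ * x)            ≈⟨ *-assoc u u⁻¹ x ⟨
    (u * u⁻¹) * x            ≈⟨ *-congʳ uu⁻¹≈1 ⟩
    1# * x                   ≈⟨ *-identityˡ x ⟩
    x                        ∎

module NatR {c ℓ} (R : CommutativeRing c ℓ) where
  open CommutativeRing R
  open import Algebra.Properties.Ring ring using (+-inverseʳ-unique; -1*x≈-x; -‿involutive; -‿distribʳ-*)
  open import Algebra.Properties.Semiring.Mult semiring using (×-homo-+; ×1-homo-*) renaming (_×_ to _×ᵤ_)
  open import Relation.Binary.Reasoning.Setoid setoid

  natR≈×1# : ∀ n → natR R n ≈ n ×ᵤ 1#
  natR≈×1# zero    = refl
  natR≈×1# (suc n) = +-congˡ (natR≈×1# n)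

  natR-homo-+ : ∀ m n → natR R (m ℕ.+ n) ≈ natR R m + natR R n
  natR-homo-+ m n = begin
    natR R (m ℕ.+ n)         ≈⟨ natR≈×1# (m ℕ.+ n) ⟩
    (m ℕ.+ n) ×ᵤ 1#          ≈⟨ ×-homo-+ 1# m n ⟩
    m ×ᵤ 1# + n ×ᵤ 1#        ≈⟨ +-cong (natR≈×1# m) (natR≈×1# n) ⟨
    natR R m + natR R n      ∎

  natR-homo-* : ∀ m n → natR R (m ℕ.* n) ≈ natR R m * natR R n
  natR-homo-* m n = begin
    natR R (m ℕ.* n)         ≈⟨ natR≈×1# (m ℕ.* n) ⟩
    (m ℕ.* n) ×ᵤ 1#          ≈⟨ ×1-homo-* m n ⟩
    (m ×ᵤ 1#) * (n ×ᵤ 1#)    ≈⟨ *-cong (natR≈×1# m) (natR≈×1# n) ⟨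
    natR R m * natR R n      ∎

  module _ {p : ℕ} (char : HasCharDividing R p) where

    natR-multiple : ∀ {n} → p ∣ n → natR R n ≈ 0#
    natR-multiple (divides q ≡.refl) = begin
      natR R (q ℕ.* p)       ≈⟨ natR-homo-* q p ⟩
      natR R q * natR R p    ≈⟨ *-congˡ char ⟩
      natR R q * 0#          ≈⟨ zeroʳ _ ⟩
      0#                     ∎

    natR-pred-* : .{{_ : NonZero p}} → ∀ x → natR R (pred p) * x ≈ - x
    natR-pred-* x = trans (*-congʳ (+-inverseʳ-unique 1# _ 1+pred≈0)) (-1*x≈-x x)
      where
      1+pred≈0 : 1# + natR R (pred p) ≈ 0#
      1+pred≈0 = trans (reflexive (≡.cong (natR R) (ℕ.suc-pred p))) char

    natR-isUnit : Prime p → ∀ {n} .{{_ : NonZero n}} → n ℕ.< p → IsUnit R (natR R n)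
    natR-isUnit p-prime {n} n<p with coprime-Bézout (prime⇒coprime p-prime n<p)
    ... | Bézout.-+ x y 1+xp≡yn = natR R y , (begin
      natR R n * natR R y    ≈⟨ *-comm _ _ ⟩
      natR R y * natR R n    ≈⟨ natR-homo-* y n ⟨
      natR R (y ℕ.* n)       ≡⟨ ≡.cong (natR R) 1+xp≡yn ⟨
      1# + natR R (x ℕ.* p)  ≈⟨ +-congˡ (natR-multiple (divides x ≡.refl)) ⟩
      1# + 0#                ≈⟨ +-identityʳ 1# ⟩
      1#                     ∎)
    ... | Bézout.+- x y 1+yn≡xp = - natR R y , (begin
      natR R n * - natR R y  ≈⟨ -‿distribʳ-* _ _ ⟨
      - (natR R n * natR R y) ≈⟨ -‿cong (trans (*-comm _ _) (sym (natR-homo-* y n))) ⟩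
      - natR R (y ℕ.* n)     ≈⟨ -‿cong (+-inverseʳ-unique 1# _ 1+yn≈0) ⟩
      - - 1#                 ≈⟨ -‿involutive 1# ⟩
      1#                     ∎)
      where
      1+yn≈0 : 1# + natR R (y ℕ.* n) ≈ 0#
      1+yn≈0 = trans (reflexive (≡.cong (natR R) 1+yn≡xp)) (natR-multiple (divides x ≡.refl))

module Matrices {c ℓ} {r : ℕ} (A : Fin r → CommutativeRing c ℓ) where
  open Prod A

  𝔸 : CommutativeRing c ℓ
  𝔸 = Π-commutativeRing A

  private module 𝔸 = CommutativeRing 𝔸
  open ℤ-RingSolver 𝔸 using (Polynomial; con; var; _:+_; _:*_; :-_; ⟦_⟧; ⟦_⟧↓; prove)

  private variable n : ℕ

  ≈M-refl : ∀ {X} → X ≈M X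
  ≈M-refl = 𝔸.refl , 𝔸.refl , 𝔸.refl , 𝔸.refl

  ≈M-sym : ∀ {X Y} → X ≈M Y → Y ≈M X
  ≈M-sym (e₁ , e₂ , e₃ , e₄) = 𝔸.sym e₁ , 𝔸.sym e₂ , 𝔸.sym e₃ , 𝔸.sym e₄

  ≈M-trans : ∀ {X Y Z} → X ≈M Y → Y ≈M Z → X ≈M Z
  ≈M-trans (e₁ , e₂ , e₃ , e₄) (f₁ , f₂ , f₃ , f₄) =
    𝔸.trans e₁ f₁ , 𝔸.trans e₂ f₂ , 𝔸.trans e₃ f₃ , 𝔸.trans e₄ f₄

  -M_ : M2 → M2
  -M X = mat (-A m11 X) (-A m12 X) (-A m21 X) (-A m22 X)

  _-M_ : M2 → M2 → M2
  X -M Y = X +M (-M Y)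

  traceless : El → El → El → M2
  traceless a b c = mat a b c (-A a)

  U L E F H : El → M2
  U t = mat 1A t 0A 1A
  L t = mat 1A 0A t 1A
  E t = mat 0A t 0A 0A
  F t = mat 0A 0A t 0A
  H t = traceless t 0A 0A

  E-cong : ∀ {s t} → s ≈A t → E s ≈M E t
  E-cong s≈t = 𝔸.refl , s≈t , 𝔸.refl , 𝔸.refl

  F-cong : ∀ {s t} → s ≈A t → F s ≈M F t
  F-cong s≈t = 𝔸.refl , 𝔸.refl , s≈t , 𝔸.refl

  H-cong : ∀ {s t} → s ≈A t → H s ≈M H t
  H-cong s≈t = s≈t , 𝔸.refl , 𝔸.refl , 𝔸.-‿cong s≈t

  TraceZero⇒traceless : ∀ {X} → TraceZero X → X ≈M traceless (m11 X) (m12 X) (m21 X)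
  TraceZero⇒traceless {X} tr≈0 = 𝔸.refl , 𝔸.refl , 𝔸.refl , +-inverseʳ-unique (m11 X) (m22 X) tr≈0
    where open import Algebra.Properties.Ring 𝔸.ring using (+-inverseʳ-unique)

  -- Matrices of solver polynomials. Their operations copy those of Defs clause by clause, so ⟦_⟧M of
  -- such an expression is definitionally the corresponding expression in M2, and a matrix identity
  -- reduces to four calls of the solver.
  record M2ᴾ (n : ℕ) : Set where
    constructor matᴾ
    field e₁₁ e₁₂ e₂₁ e₂₂ : Polynomial n

  ⟦_⟧M : M2ᴾ n → Vec El n → M2
  ⟦ matᴾ a b c d ⟧M ρ = mat (⟦ a ⟧ ρ) (⟦ b ⟧ ρ) (⟦ c ⟧ ρ) (⟦ d ⟧ ρ)

  ⟦_⟧↓M : M2ᴾ n → Vec El n → M2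
  ⟦ matᴾ a b c d ⟧↓M ρ = mat (⟦ a ⟧↓ ρ) (⟦ b ⟧↓ ρ) (⟦ c ⟧↓ ρ) (⟦ d ⟧↓ ρ)

  proveM : ∀ (ρ : Vec El n) P Q → ⟦ P ⟧↓M ρ ≈M ⟦ Q ⟧↓M ρ → ⟦ P ⟧M ρ ≈M ⟦ Q ⟧M ρ
  proveM ρ (matᴾ a b c d) (matᴾ a′ b′ c′ d′) (e₁ , e₂ , e₃ , e₄) =
    prove ρ a a′ e₁ , prove ρ b b′ e₂ , prove ρ c c′ e₃ , prove ρ d d′ e₄

  0ᴾ 1ᴾ twoᴾ x₀ : Polynomial (suc n)
  0ᴾ   = con (+ 0)
  1ᴾ   = con (+ 1)
  twoᴾ = 1ᴾ :+ (1ᴾ :+ 0ᴾ)   -- the shape of ιA 2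
  x₀   = var Fin.zero

  x₁ : Polynomial (suc (suc n))
  x₁ = var (Fin.suc Fin.zero)

  x₂ : Polynomial (suc (suc (suc n)))
  x₂ = var (Fin.suc (Fin.suc Fin.zero))

  _+ᴾ_ _-ᴾ_ _*ᴾ_ : M2ᴾ n → M2ᴾ n → M2ᴾ n
  matᴾ a b c d +ᴾ matᴾ a′ b′ c′ d′ = matᴾ (a :+ a′) (b :+ b′) (c :+ c′) (d :+ d′)
  matᴾ a b c d -ᴾ matᴾ a′ b′ c′ d′ = matᴾ (a :+ :- a′) (b :+ :- b′) (c :+ :- c′) (d :+ :- d′)
  matᴾ a b c d *ᴾ matᴾ a′ b′ c′ d′ =
    matᴾ (a :* a′ :+ b :* c′) (a :* b′ :+ b :* d′) (c :* a′ :+ d :* c′) (c :* b′ :+ d :* d′)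

  detᴾ : M2ᴾ n → Polynomial n
  detᴾ (matᴾ a b c d) = a :* d :+ :- (b :* c)

  conjᴾ : M2ᴾ (suc n) → M2ᴾ (suc n) → M2ᴾ (suc n)
  conjᴾ g@(matᴾ a b c d) X = (g *ᴾ X) *ᴾ matᴾ d (:- b) (:- c) a

  tracelessᴾ : Polynomial (suc n) → Polynomial (suc n) → Polynomial (suc n) → M2ᴾ (suc n)
  tracelessᴾ a b c = matᴾ a b c (:- a)

  Uᴾ Lᴾ Eᴾ Fᴾ Hᴾ : Polynomial (suc n) → M2ᴾ (suc n)
  Uᴾ t = matᴾ 1ᴾ t 0ᴾ 1ᴾ
  Lᴾ t = matᴾ 1ᴾ 0ᴾ t 1ᴾ
  Eᴾ t = matᴾ 0ᴾ t 0ᴾ 0ᴾ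
  Fᴾ t = matᴾ 0ᴾ 0ᴾ t 0ᴾ
  Hᴾ t = tracelessᴾ t 0ᴾ 0ᴾ

  U-SL2 : ∀ t → InSL2 (U t)
  U-SL2 t = prove (t ∷ []) (detᴾ (Uᴾ x₀)) 1ᴾ 𝔸.refl

  L-SL2 : ∀ t → InSL2 (L t)
  L-SL2 t = prove (t ∷ []) (detᴾ (Lᴾ x₀)) 1ᴾ 𝔸.refl

  traceless≈H+E+F : ∀ a b c → traceless a b c ≈M ((H a +M E b) +M F c)
  traceless≈H+E+F a b c = proveM (a ∷ b ∷ c ∷ [])
    (tracelessᴾ x₀ x₁ x₂) ((Hᴾ x₀ +ᴾ Eᴾ x₁) +ᴾ Fᴾ x₂) ≈M-refl

  traceless-0b0≈E : ∀ b → traceless 0A b 0A ≈M E b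
  traceless-0b0≈E b = proveM (b ∷ []) (tracelessᴾ 0ᴾ x₀ 0ᴾ) (Eᴾ x₀) ≈M-refl

  conj-L-E : ∀ x y → (conj (L (-A x)) (E y) -M conj (L x) (E y)) ≈M H ((ιA 2 *A y) *A x)
  conj-L-E x y = proveM (x ∷ y ∷ [])
    (conjᴾ (Lᴾ (:- x₀)) (Eᴾ x₁) -ᴾ conjᴾ (Lᴾ x₀) (Eᴾ x₁)) (Hᴾ ((twoᴾ :* x₁) :* x₀)) ≈M-refl

  conj-L-H : ∀ s → (conj (L 1A) (H s) -M H s) ≈M F (ιA 2 *A s)
  conj-L-H s = proveM (s ∷ []) (conjᴾ (Lᴾ 1ᴾ) (Hᴾ x₀) -ᴾ Hᴾ x₀) (Fᴾ (twoᴾ :* x₀)) ≈M-refl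

  conj-U⁻¹-upper : ∀ a b → (conj (U (-A 1A)) (traceless a b 0A) -M traceless a b 0A) ≈M E (ιA 2 *A a)
  conj-U⁻¹-upper a b = proveM (a ∷ b ∷ [])
    (conjᴾ (Uᴾ (:- 1ᴾ)) (tracelessᴾ x₀ x₁ 0ᴾ) -ᴾ tracelessᴾ x₀ x₁ 0ᴾ) (Eᴾ (twoᴾ :* x₀)) ≈M-refl

  conj-U±1-second-difference : ∀ a b c → let X = traceless a b c in
    ((X +M X) -M (conj (U 1A) X +M conj (U (-A 1A)) X)) ≈M E (ιA 2 *A c)
  conj-U±1-second-difference a b c = proveM (a ∷ b ∷ c ∷ [])
    ((X +ᴾ X) -ᴾ (conjᴾ (Uᴾ 1ᴾ) X +ᴾ conjᴾ (Uᴾ (:- 1ᴾ)) X)) (Eᴾ (twoᴾ :* x₂)) ≈M-refl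
    where X = tracelessᴾ x₀ x₁ x₂

module Generation {c ℓ v} (p : ℕ) (p-prime : Prime p) (2<p : 2 ℕ.< p)
  {r : ℕ} (A : Fin r → CommutativeRing c ℓ) (char : ∀ i → HasCharDividing (A i) p)
  (V : Prod.M2 A → Set v) (V-subspace : Prod.IsFpSubspaceOfSl2 A p V)
  (V-conj : ∀ g X → Prod.InSL2 A g → V X → V (Prod.conj A g X)) where
  open Prod A
  open Matrices A
  open IsFpSubspaceOfSl2 V-subspace
  open Units 𝔸 using (*-preserves-isUnit; inverse-cancelˡ)
  module NatRᵢ (i : Fin r) = NatR (A i)

  private instance
    p-nonZero : NonZero p
    p-nonZero = prime⇒nonZero p-prime

  ιA-isUnit : ∀ {n} .{{_ : NonZero n}} → n ℕ.< p → IsUnit 𝔸 (ιA n)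
  ιA-isUnit n<p = Π-isUnit A (λ i → NatRᵢ.natR-isUnit i (char i) p-prime n<p)

  embedFp-traceless : ∀ a b c d → p ∣ a ℕ.+ d → embedFp a b c d ≈M traceless (ιA a) (ιA b) (ιA c)
  embedFp-traceless a _ _ d p∣a+d = TraceZero⇒traceless λ i → let open CommutativeRing (A i) in
    trans (sym (NatRᵢ.natR-homo-+ i a d)) (NatRᵢ.natR-multiple i (char i) p∣a+d)

  V-neg : ∀ {X} → V X → V (-M X)
  V-neg {X} X∈V = respects (neg (m11 X) , neg (m12 X) , neg (m21 X) , neg (m22 X))
    (≡.subst (λ k → V (ιA k ·M X)) (toℕ-fromℕ< p-1<p) (·-closed (fromℕ< p-1<p) X∈V))
    where
    p-1<p : pred p ℕ.< p
    p-1<p = ℕ.≤-reflexive (ℕ.suc-pred p)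
    neg : ∀ x → (ιA (pred p) *A x) ≈A (-A x)
    neg x i = NatRᵢ.natR-pred-* i (char i) (x i)

  V-sub : ∀ {X Y} → V X → V Y → V (X -M Y)
  V-sub X∈V Y∈V = +-closed X∈V (V-neg Y∈V)

  E-isUnit⇒V-all : ∀ {y} → IsUnit 𝔸 y → V (E y) → ∀ X → TraceZero X → V X
  E-isUnit⇒V-all {y} y-unit Ey∈V X tr≈0 =
    respects (≈M-sym (≈M-trans (TraceZero⇒traceless tr≈0) (traceless≈H+E+F _ _ _)))
      (+-closed (+-closed (H∈V (m11 X)) (E∈V (m12 X))) (F∈V (m21 X)))
    where
    ½ : El
    ½ = proj₁ (ιA-isUnit 2<p)
    2·½≈1 : (ιA 2 *A ½) ≈A 1A
    2·½≈1 = proj₂ (ιA-isUnit 2<p)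

    H∈V : ∀ s → V (H s)
    H∈V s with *-preserves-isUnit (ιA-isUnit 2<p) y-unit
    ... | w , 2y·w≈1 = respects (≈M-trans (conj-L-E (w *A s) y) (H-cong (inverse-cancelˡ 2y·w≈1 s)))
      (V-sub (V-conj _ _ (L-SL2 _) Ey∈V) (V-conj _ _ (L-SL2 _) Ey∈V))

    E∈V : ∀ t → V (E t)
    E∈V t = respects (≈M-trans (conj-U⁻¹-upper (½ *A t) 0A) (E-cong (inverse-cancelˡ 2·½≈1 t)))
      (V-sub (V-conj _ _ (U-SL2 _) (H∈V _)) (H∈V _))

    F∈V : ∀ t → V (F t)
    F∈V t = respects (≈M-trans (conj-L-H (½ *A t)) (F-cong (inverse-cancelˡ 2·½≈1 t)))
      (V-sub (V-conj _ _ (L-SL2 _) (H∈V _)) (H∈V _))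

  traceless-Fp⇒E-isUnit : ∀ a b c → a ℕ.< p → b ℕ.< p → c ℕ.< p → ¬ (a ≡ 0 × b ≡ 0 × c ≡ 0) →
    V (traceless (ιA a) (ιA b) (ιA c)) → ∃ λ y → IsUnit 𝔸 y × V (E y)
  traceless-Fp⇒E-isUnit a b (suc c) _ _ c<p _ X∈V =
    ιA 2 *A ιA (suc c) , *-preserves-isUnit (ιA-isUnit 2<p) (ιA-isUnit c<p) ,
    respects (conj-U±1-second-difference _ _ _)
      (V-sub (+-closed X∈V X∈V) (+-closed (V-conj _ _ (U-SL2 _) X∈V) (V-conj _ _ (U-SL2 _) X∈V)))
  traceless-Fp⇒E-isUnit (suc a) b zero a<p _ _ _ X∈V =
    ιA 2 *A ιA (suc a) , *-preserves-isUnit (ιA-isUnit 2<p) (ιA-isUnit a<p) ,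
    respects (conj-U⁻¹-upper _ _) (V-sub (V-conj _ _ (U-SL2 _) X∈V) X∈V)
  traceless-Fp⇒E-isUnit zero (suc b) zero _ b<p _ _ X∈V =
    ιA (suc b) , ιA-isUnit b<p , respects (traceless-0b0≈E _) X∈V
  traceless-Fp⇒E-isUnit zero zero zero _ _ _ nonzero _ = ⊥-elim (nonzero (≡.refl , ≡.refl , ≡.refl))

∣∧<⇒≡0 : ∀ {p d} → p ∣ d → d ℕ.< p → d ≡ 0
∣∧<⇒≡0 {d = zero}  _   _   = ≡.refl
∣∧<⇒≡0 {d = suc _} p∣d d<p = ⊥-elim (>⇒∤ d<p p∣d)

open import Data.Nat using (_≤_; _+_)

propositionA2p5 :
    {c ℓ v : Level} (p : ℕ) → Prime p → 3 ≤ p →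
    (r : ℕ) (A : Fin r → CommutativeRing c ℓ) →
    (∀ i → IsLocal (A i)) →
    (∀ i → HasCharDividing (A i) p) →
    let open Prod A in
    (V : M2 → Set v) →
    IsFpSubspaceOfSl2 p V →
    (∀ g X → InSL2 g → V X → V (conj g X)) →
    (a b c' d : Fin p) →
    p ∣ (toℕ a + toℕ d) →
    ¬ (toℕ a ≡ 0 × toℕ b ≡ 0 × toℕ c' ≡ 0 × toℕ d ≡ 0) →
    V (embedFp (toℕ a) (toℕ b) (toℕ c') (toℕ d)) →
    ∀ X → TraceZero X → V X
propositionA2p5 p p-prime 3≤p _ A _ char V V-subspace V-conj a b c d p∣a+d nonzero X∈V =
  let y , y-unit , Ey∈V = traceless-Fp⇒E-isUnit (toℕ a) (toℕ b) (toℕ c) (toℕ<n a) (toℕ<n b) (toℕ<n c)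
                            nonzero′ (respects (embedFp-traceless (toℕ a) (toℕ b) (toℕ c) (toℕ d) p∣a+d) X∈V)
  in E-isUnit⇒V-all y-unit Ey∈V
  where
  open Generation p p-prime 3≤p A char V V-subspace V-conj
  open Prod.IsFpSubspaceOfSl2 V-subspace using (respects)
  nonzero′ : ¬ (toℕ a ≡ 0 × toℕ b ≡ 0 × toℕ c ≡ 0)
  nonzero′ (a≡0 , b≡0 , c≡0) = nonzero (a≡0 , b≡0 , c≡0 , d≡0)
    where d≡0 = ∣∧<⇒≡0 (≡.subst (λ k → p ∣ k + toℕ d) a≡0 p∣a+d) (toℕ<n d)
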